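{- Let $G$ be a finite group of order $n$ and exponent $e$, and let $\rho_G$ be the character of the regular representation of $G$. Then $$\Theta_G(\rho_G)=\frac{n}{e}\sum_{m\mid e}\frac{e}{m}\cdot\frac{m-1}{2}\sum_{\substack{s\in G\\ |s|=m}}s=\sum_{m\mid e}\frac{n}{m}\cdot\frac{m-1}{2}\sum_{\substack{s\in G\\ |s|=m}}s,$$ where $|s|$ denotes the order of $s$.
   Context: The pairing $\langle\cdot,\cdot\rangle:\mathbb{Q}R_G\times\mathbb{Q}G\to\mathbb{Q}$ ($R_G$ the virtual character ring of $G$) is defined as follows: if $\chi$ is a character of degree $1$ of a group containing $s$, then $\langle\chi,s\rangle$ is the unique rational number with $0\le\langle\chi,s\rangle<1$ and $\chi(s)=e^{2\pi i\langle\chi,s\rangle}$; this is extended additively to characters of the cyclic group $\langle s\rangle$; for an arbitrary character $\chi$ of $G$, $\langle\chi,s\rangle=\langle\operatorname{res}^G_{\langle s\rangle}\chi,s\rangle$; then extend $\mathbb{Q}$-bilinearly. The Stickelberger map is $\Theta_G:\mathbb{Q}R_G\to\mathbb{Q}G$, $\Theta_G(\chi)=\sum_{s\in G}\langle\chi,s\rangle s$. -}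

module Defs where

open import Level using (Level; _⊔_)
open import Data.Nat as ℕ using (ℕ; zero; suc; _≤_; _<_; _∸_; _≡ᵇ_)
open import Data.Nat.DivMod using (_/_)
open import Data.Nat.Divisibility using (_∣?_)
open import Data.Fin as Fin using (Fin; toℕ)
open import Data.List using (List; length; filter; allFin)
open import Data.Integer using (+_)
open import Data.Rational as ℚ using (ℚ; 0ℚ; 1ℚ)
open import Data.Bool using (if_then_else_)
open import Data.Product using (Σ; ∃; _×_)
open import Relation.Nullary using (¬_; does)
open import Relation.Binary.PropositionalEquality using (_≡_; _≢_)
open import Algebra.Structures using (IsGroup)
open import Algebra.Bundles using (CommutativeRing)
open import Function.Bundles using (_⇔_)

record FinGroup (n : ℕ) : Set where
  field
    _∙_     : Fin n → Fin n → Fin n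
    ε       : Fin n
    _⁻¹     : Fin n → Fin n
    isGroup : IsGroup _≡_ _∙_ ε _⁻¹

module _ {n : ℕ} (G : FinGroup n) where
  open FinGroup G

  pow : Fin n → ℕ → Fin n
  pow s zero    = ε
  pow s (suc k) = s ∙ pow s k

  IsOrder : Fin n → ℕ → Set
  IsOrder s m = (1 ≤ m) × (pow s m ≡ ε) × (∀ k → 1 ≤ k → k < m → pow s k ≢ ε)

  IsExponent : ℕ → Set
  IsExponent e = (1 ≤ e) × (∀ s → pow s e ≡ ε)
                 × (∀ k → 1 ≤ k → k < e → ∃ λ s → pow s k ≢ ε)

  -- number of fixed points of left multiplication by g on G
  -- (= trace of g in the regular representation)
  regFix : Fin n → ℕ
  regFix g = length (filter (λ h → (g ∙ h) Fin.≟ h) (allFin n))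

-- j / m as a rational (0 when m = 0; never used with m = 0)
frac : ℕ → ℕ → ℚ
frac j zero    = 0ℚ
frac j (suc k) = (+ j) ℚ./ suc k

-- e / m in ℕ (0 when m = 0)
quot : ℕ → ℕ → ℕ
quot e zero    = 0
quot e (suc k) = e / suc k

sumℚ : ∀ {m} → (Fin m → ℚ) → ℚ
sumℚ {zero}  f = 0ℚ
sumℚ {suc m} f = f Fin.zero ℚ.+ sumℚ (λ i → f (Fin.suc i))

-- sum over 1 ≤ m ≤ e
sumRange : ℕ → (ℕ → ℚ) → ℚ
sumRange zero    f = 0ℚ
sumRange (suc e) f = sumRange e f ℚ.+ f (suc e)

-- The rational group algebra ℚG, as coefficient functions G → ℚ.

QG : ℕ → Set
QG n = Fin n → ℚ

sumDiv : ∀ {n} → ℕ → (ℕ → QG n) → QG n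
sumDiv e f t = sumRange e (λ m → if does (m ∣? e) then f m t else 0ℚ)

-- ∑_{s ∈ G, |s| = m} s
elemsOfOrder : ∀ {n} → (Fin n → ℕ) → ℕ → QG n
elemsOfOrder ord m t = if ord t ≡ᵇ m then 1ℚ else 0ℚ

_·_ : ∀ {n} → ℚ → QG n → QG n
(q · x) t = q ℚ.* x t

-- Characters with values in a field K of characteristic 0 (playing the
-- role of ℂ) containing a primitive e-th root of unity ζ (playing the
-- role of e^{2πi/e}).

module _ {c ℓ : Level} (K : CommutativeRing c ℓ) where
  open CommutativeRing K

  powK : Carrier → ℕ → Carrier
  powK x zero    = 1#
  powK x (suc k) = x * powK x k

  natK : ℕ → Carrier
  natK zero    = 0#
  natK (suc k) = 1# + natK k

  sumK : ∀ {m} → (Fin m → Carrier) → Carrier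
  sumK {zero}  f = 0#
  sumK {suc m} f = f Fin.zero + sumK (λ i → f (Fin.suc i))

  IsField : Set (c ⊔ ℓ)
  IsField = ¬ (1# ≈ 0#) × (∀ x → ¬ (x ≈ 0#) → ∃ λ y → x * y ≈ 1#)

  CharZero : Set ℓ
  CharZero = ∀ k → ¬ (natK (suc k) ≈ 0#)

  IsPrimitiveRoot : ℕ → Carrier → Set ℓ
  IsPrimitiveRoot e ζ = (powK ζ e ≈ 1#) × (∀ k → 1 ≤ k → k < e → ¬ (powK ζ k ≈ 1#))

  module _ {n : ℕ} (G : FinGroup n) (e : ℕ) (ζ : Carrier) where

    regChar : Fin n → Carrier
    regChar g = natK (regFix G g)

    -- For s of order m (m ∣ e), the degree-1 characters of ⟨s⟩ are
    -- χ_j (j < m) with χ_j(s) = ζ^{(e/m) j}  (i.e. e^{2πi j/m}),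
    -- so that ⟨χ_j , s⟩ = j/m.  Value of χ_j at s^k:
    linChar : (m : ℕ) → Fin m → ℕ → Carrier
    linChar m j k = powK ζ (quot e m ℕ.* toℕ j ℕ.* k)

    -- q = ⟨χ , s⟩ for a character χ of G and s of order m:
    -- res χ to ⟨s⟩ equals ∑_j a_j χ_j and q = ∑_j a_j ⟨χ_j , s⟩.
    IsPairing : (Fin n → Carrier) → Fin n → (m : ℕ) → ℚ → Set ℓ
    IsPairing χ s m q =
      Σ (Fin m → ℕ) λ a →
        (∀ k → k < m → χ (pow G s k) ≈ sumK (λ j → natK (a j) * linChar m j k))
        × (q ≡ sumℚ (λ j → frac (a j) 1 ℚ.* frac (toℕ j) m))

    -- θ = Θ_G(χ) = ∑_{s ∈ G} ⟨χ , s⟩ s, i.e. for each s, θ(s) is the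
    -- (unique) value of ⟨χ , s⟩.
    IsStickelberger : (Fin n → ℕ) → (Fin n → Carrier) → QG n → Set ℓ
    IsStickelberger ord χ θ = ∀ s q → IsPairing χ s (ord s) q ⇔ (q ≡ θ s)

-- Fix s ∈ G of order m.  Then m ∣ e; write e = d·m, so ω = ζ^d is a
-- primitive m-th root of unity and the characters of ⟨s⟩ are
-- χ_j(s^k) = ω^(jk) with ⟨χ_j, s⟩ = j/m (j < m).  The regular character
-- ρ_G is n at ε and 0 elsewhere, and m ∣ n (Lagrange for ⟨s⟩), so by the
-- orthogonality of the χ_j the restriction of ρ_G to ⟨s⟩ is (n/m)·∑_j χ_j,
-- and this decomposition is unique.  Hence
--   ⟨ρ_G, s⟩ = (n/m)·∑_{j<m} j/m = (n/m)·(m-1)/2,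
-- which is also the coefficient of s in both elements of ℚG in the
-- statement, because (n/e)·(e/m) = n/m.
module Submission where

open import Defs
open import Level using (Level; 0ℓ)
open import Data.Nat as ℕ using (ℕ; _∸_; zero; suc; _≤_; _<_; z≤n; s≤s; _≤?_)
import Data.Nat.Properties as ℕP
open import Data.Nat.DivMod using (_%_; _/_; m≡m%n+[m/n]*n; m%n<n; m/n*n≡m)
open import Data.Nat.Divisibility
  using (_∣_; divides; quotient; m%n≡0⇒n∣m; m∣n⇒n≡quotient*m)
open import Data.Fin as Fin using (Fin; toℕ; fromℕ<)
import Data.Fin.Properties as FinP
open import Data.Fin.Permutation using (Permutation; permutation)
open import Data.List using (allFin; length)
import Data.List.Properties as ListP
import Data.List.Relation.Unary.All as All
open import Data.List.Relation.Unary.All.Properties using (tabulate⁺)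
open import Data.List.Membership.Propositional.Properties using (∈-allFin)
open import Data.List.Extrema.Nat using (argmin; f[argmin]≤f[xs])
open import Data.Product using (_×_; _,_; proj₁; proj₂)
open import Data.Sum using (inj₁; inj₂)
open import Data.Empty using (⊥-elim)
open import Function using (_∘_)
open import Function.Bundles using (_⇔_; mk⇔; Equivalence)
open import Relation.Nullary using (Dec; yes; no; ¬_; does)
open import Relation.Nullary.Decidable using (dec-true; dec-false)
open import Relation.Binary.Definitions using (tri<; tri≈; tri>)
open import Relation.Binary.PropositionalEquality using (_≡_)
import Relation.Binary.PropositionalEquality as ≡
open ≡ using (_≢_; module ≡-Reasoning)
open import Algebra.Bundles using (CommutativeMonoid; Group; CommutativeRing)
import Data.Rational

module MonoidSum {c ℓ : Level} (M : CommutativeMonoid c ℓ) where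
  open CommutativeMonoid M using (Carrier; _≈_; trans; ∙-congˡ; identityʳ) renaming (ε to 0#)
  open import Algebra.Properties.CommutativeMonoid.Sum M
    using (sum; sum-remove; sum-cong-≋; sum-replicate-zero)

  sum-δ : ∀ {m} (f : Fin m → Carrier) (i₀ : Fin m) →
          (∀ i → i ≢ i₀ → f i ≈ 0#) → sum f ≈ f i₀
  sum-δ {suc m} f i₀ f≈0 =
    trans (sum-remove {i = i₀} f)
      (trans (∙-congˡ (trans (sum-cong-≋ (λ j → f≈0 _ (FinP.punchInᵢ≢i i₀ j)))
                             (sum-replicate-zero m)))
             (identityʳ (f i₀)))

module NatSum where
  open import Algebra.Properties.Semiring.Sum ℕP.+-*-semiring public
    using (sum; sum-cong-≋; ∑-comm; sum-permute; sum-init-last; *-distribˡ-sum)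
  open MonoidSum ℕP.+-0-commutativeMonoid public

  sum-const : ∀ m c → sum {m} (λ _ → c) ≡ m ℕ.* c
  sum-const zero    c = ≡.refl
  sum-const (suc m) c = ≡.cong (c ℕ.+_) (sum-const m c)

module GroupFacts {n : ℕ} (G : FinGroup n) where
  open FinGroup G
  open import Algebra.Structures using (IsGroup)
  open IsGroup isGroup using (assoc; identityˡ; identityʳ)
  open ≡-Reasoning

  -- G as a library group, so that its cancellation laws can be reused.
  asGroup : Group 0ℓ 0ℓ
  asGroup = record { isGroup = isGroup }

  open Group asGroup using (_\\_)
  open import Algebra.Properties.Group asGroup
    using (loop; quasigroup; \\-leftDividesˡ; \\-leftDividesʳ)
  open import Algebra.Properties.Loop loop using (identityˡ-unique)
  open import Algebra.Properties.Quasigroup quasigroup public using (cancelʳ)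

  regFix-ε : regFix G ε ≡ n
  regFix-ε = ≡.trans (≡.cong length (ListP.filter-all _ (tabulate⁺ identityˡ)))
                     (ListP.length-tabulate _)

  regFix-≢ε : ∀ g → g ≢ ε → regFix G g ≡ 0
  regFix-≢ε g g≢ε = ≡.cong length (ListP.filter-none _
    (tabulate⁺ (λ h gh≡h → g≢ε (identityˡ-unique g h gh≡h))))

  translation : Fin n → Permutation n n
  translation g = permutation (g ∙_) (g \\_) (\\-leftDividesˡ g) (\\-leftDividesʳ g)

  pow-+ : ∀ s a b → pow G s (a ℕ.+ b) ≡ pow G s a ∙ pow G s b
  pow-+ s zero    b = ≡.sym (identityˡ _)
  pow-+ s (suc a) b = ≡.trans (≡.cong (s ∙_) (pow-+ s a b)) (≡.sym (assoc _ _ _))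

  pow-act : ∀ s a b x → pow G s a ∙ (pow G s b ∙ x) ≡ pow G s (a ℕ.+ b) ∙ x
  pow-act s a b x = ≡.trans (≡.sym (assoc _ _ x)) (≡.cong (_∙ x) (≡.sym (pow-+ s a b)))

  module Cyclic (s : Fin n) (m : ℕ) (order : IsOrder G s m) where
    private
      instance
        m≢0 : ℕ.NonZero m
        m≢0 = ℕ.>-nonZero (proj₁ order)

    pow-m : pow G s m ≡ ε
    pow-m = proj₁ (proj₂ order)

    pow-multiple : ∀ q → pow G s (q ℕ.* m) ≡ ε
    pow-multiple zero    = ≡.refl
    pow-multiple (suc q) = begin
      pow G s (m ℕ.+ q ℕ.* m)          ≡⟨ pow-+ s m (q ℕ.* m) ⟩
      pow G s m ∙ pow G s (q ℕ.* m)    ≡⟨ ≡.cong₂ _∙_ pow-m (pow-multiple q) ⟩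
      ε ∙ ε                            ≡⟨ identityˡ ε ⟩
      ε                                ∎

    pow-periodic : ∀ a → pow G s (a ℕ.+ m) ≡ pow G s a
    pow-periodic a = begin
      pow G s (a ℕ.+ m)          ≡⟨ pow-+ s a m ⟩
      pow G s a ∙ pow G s m      ≡⟨ ≡.cong (pow G s a ∙_) pow-m ⟩
      pow G s a ∙ ε              ≡⟨ identityʳ _ ⟩
      pow G s a                  ∎

    pow-mod : ∀ a → pow G s a ≡ pow G s (a % m)
    pow-mod a = begin
      pow G s a                                ≡⟨ ≡.cong (pow G s) (m≡m%n+[m/n]*n a m) ⟩
      pow G s (a % m ℕ.+ a / m ℕ.* m)          ≡⟨ pow-+ s (a % m) _ ⟩
      pow G s (a % m) ∙ pow G s (a / m ℕ.* m)  ≡⟨ ≡.cong (pow G s (a % m) ∙_) (pow-multiple (a / m)) ⟩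
      pow G s (a % m) ∙ ε                      ≡⟨ identityʳ _ ⟩
      pow G s (a % m)                          ∎

    pow-small : ∀ r → r < m → pow G s r ≡ ε → r ≡ 0
    pow-small zero    _   _ = ≡.refl
    pow-small (suc r) r<m eq = ⊥-elim (proj₂ (proj₂ order) (suc r) (s≤s z≤n) r<m eq)

    order-divides : ∀ a → pow G s a ≡ ε → m ∣ a
    order-divides a eq =
      m%n≡0⇒n∣m a m (pow-small (a % m) (m%n<n a m) (≡.trans (≡.sym (pow-mod a)) eq))

    -- If s^a = s^b with a < b < m, then s^(b-a) = ε with 0 < b-a < m.
    pow-distinct : ∀ a b → a < b → b < m → pow G s a ≢ pow G s b
    pow-distinct a b a<b b<m eq =
      proj₂ (proj₂ order) (b ∸ a) (ℕP.m<n⇒0<n∸m a<b) (ℕP.≤-<-trans (ℕP.m∸n≤m b a) b<m)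
        (identityˡ-unique _ _ (≡.sym (begin
          pow G s a                    ≡⟨ eq ⟩
          pow G s b                    ≡⟨ ≡.cong (pow G s) (ℕP.m∸n+n≡m (ℕP.<⇒≤ a<b)) ⟨
          pow G s (b ∸ a ℕ.+ a)        ≡⟨ pow-+ s (b ∸ a) a ⟩
          pow G s (b ∸ a) ∙ pow G s a  ∎)))

    pow-injective : ∀ a b → a < m → b < m → pow G s a ≡ pow G s b → a ≡ b
    pow-injective a b a<m b<m eq with ℕP.<-cmp a b
    ... | tri≈ _ a≡b _ = a≡b
    ... | tri< a<b _ _ = ⊥-elim (pow-distinct a b a<b b<m eq)
    ... | tri> _ _ b<a = ⊥-elim (pow-distinct b a b<a a<m (≡.sym eq))

indicator : {A : Set} → Dec A → ℕ
indicator (yes _) = 1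
indicator (no _)  = 0

indicator-yes : {A : Set} (d : Dec A) → A → indicator d ≡ 1
indicator-yes (yes _) _ = ≡.refl
indicator-yes (no ¬a) a = ⊥-elim (¬a a)

indicator-no : {A : Set} (d : Dec A) → ¬ A → indicator d ≡ 0
indicator-no (yes a) ¬a = ⊥-elim (¬a a)
indicator-no (no _)  _  = ≡.refl

-- Call x least if it carries the smallest label in its orbit
-- {s^k x | k < m}.  Every orbit has exactly one least element, so
--   n = ∑_y ∑_{k<m} [s^k y least] = ∑_{k<m} ∑_y [s^k y least] = m · #least,
-- where the last step uses that y ↦ s^k y permutes G.
module Lagrange {n : ℕ} (G : FinGroup n) (s : Fin n) (m′ : ℕ)
                (order : IsOrder G s (suc m′)) where
  open FinGroup G
  open GroupFacts G
  open Cyclic s (suc m′) order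
  open NatSum
  open ≡-Reasoning

  m : ℕ
  m = suc m′

  orbit : Fin n → Fin m → Fin n
  orbit x k = pow G s (toℕ k) ∙ x

  IsLeast : Fin n → Set
  IsLeast x = ∀ k → toℕ x ≤ toℕ (orbit x k)

  least? : ∀ x → Dec (IsLeast x)
  least? x = FinP.all? (λ k → toℕ x ≤? toℕ (orbit x k))

  leastExp : Fin n → Fin m
  leastExp y = argmin (λ k → toℕ (orbit y k)) Fin.zero (allFin m)

  leastExp-≤ : ∀ y k → toℕ (orbit y (leastExp y)) ≤ toℕ (orbit y k)
  leastExp-≤ y k =
    All.lookup (f[argmin]≤f[xs] {f = λ k → toℕ (orbit y k)} Fin.zero (allFin m)) (∈-allFin k)

  reduce : ℕ → Fin m
  reduce a = fromℕ< (m%n<n a m)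

  reduce-pow : ∀ a x → pow G s a ∙ x ≡ orbit x (reduce a)
  reduce-pow a x =
    ≡.cong (_∙ x) (≡.trans (pow-mod a) (≡.cong (pow G s) (≡.sym (FinP.toℕ-fromℕ< (m%n<n a m)))))

  leastExp-least : ∀ y → IsLeast (orbit y (leastExp y))
  leastExp-least y j = ℕP.≤-trans (leastExp-≤ y (reduce (toℕ j ℕ.+ toℕ k₀)))
    (ℕP.≤-reflexive (≡.cong toℕ (≡.sym
      (≡.trans (pow-act s (toℕ j) (toℕ k₀) y) (reduce-pow (toℕ j ℕ.+ toℕ k₀) y)))))
    where k₀ = leastExp y

  least-unique : ∀ y k → IsLeast (orbit y k) → k ≡ leastExp y
  least-unique y k least =
    FinP.toℕ-injective (pow-injective (toℕ k) (toℕ k₀) (FinP.toℕ<n k) (FinP.toℕ<n k₀)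
      (cancelʳ y (pow G s (toℕ k)) (pow G s (toℕ k₀))
        (FinP.toℕ-injective (ℕP.≤-antisym below (leastExp-≤ y k)))))
    where
    k₀ = leastExp y
    -- s^t with t = k₀ + (m - k) carries s^k y to s^k₀ y.
    t = toℕ k₀ ℕ.+ (m ∸ toℕ k)
    back : orbit (orbit y k) (reduce t) ≡ orbit y k₀
    back = begin
      orbit (orbit y k) (reduce t)   ≡⟨ reduce-pow t (orbit y k) ⟨
      pow G s t ∙ orbit y k          ≡⟨ pow-act s t (toℕ k) y ⟩
      pow G s (t ℕ.+ toℕ k) ∙ y      ≡⟨ ≡.cong (λ a → pow G s a ∙ y) t+k≡k₀+m ⟩
      pow G s (toℕ k₀ ℕ.+ m) ∙ y     ≡⟨ ≡.cong (_∙ y) (pow-periodic (toℕ k₀)) ⟩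
      orbit y k₀                     ∎
      where
      t+k≡k₀+m : t ℕ.+ toℕ k ≡ toℕ k₀ ℕ.+ m
      t+k≡k₀+m = ≡.trans (ℕP.+-assoc (toℕ k₀) (m ∸ toℕ k) (toℕ k))
                         (≡.cong (toℕ k₀ ℕ.+_) (ℕP.m∸n+n≡m (ℕP.<⇒≤ (FinP.toℕ<n k))))
    below : toℕ (orbit y k) ≤ toℕ (orbit y k₀)
    below = ℕP.≤-trans (least (reduce t)) (ℕP.≤-reflexive (≡.cong toℕ back))

  leastCount : Fin n → ℕ
  leastCount x = indicator (least? x)

  orbit-leastCount : ∀ y → sum (λ k → leastCount (orbit y k)) ≡ 1
  orbit-leastCount y = ≡.trans
    (sum-δ (λ k → leastCount (orbit y k)) (leastExp y)
      (λ k k≢k₀ → indicator-no (least? _) (λ least → k≢k₀ (least-unique y k least))))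
    (indicator-yes (least? _) (leastExp-least y))

  -- Double counting of the pairs (y, k) with s^k y least.
  lagrange : m ∣ n
  lagrange = divides (sum leastCount) (begin
    n                                               ≡⟨ ℕP.*-identityʳ n ⟨
    n ℕ.* 1                                         ≡⟨ sum-const n 1 ⟨
    sum {n} (λ _ → 1)                               ≡⟨ sum-cong-≋ (≡.sym ∘ orbit-leastCount) ⟩
    sum (λ y → sum (λ k → leastCount (orbit y k)))  ≡⟨ ∑-comm (λ y k → leastCount (orbit y k)) ⟩
    sum (λ k → sum (λ y → leastCount (orbit y k)))  ≡⟨ sum-cong-≋ {m} translate ⟨
    sum {m} (λ _ → sum leastCount)                  ≡⟨ sum-const m (sum leastCount) ⟩
    m ℕ.* sum leastCount                            ≡⟨ ℕP.*-comm m _ ⟩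
    sum leastCount ℕ.* m                            ∎)
    where
    translate : ∀ k → sum leastCount ≡ sum (λ y → leastCount (orbit y k))
    translate k = sum-permute leastCount (translation (pow G s (toℕ k)))

-- Defs spells
-- powers, numerals and finite sums by explicit recursion; they coincide
-- with the library notions _^_, _× 1# and sum, whose laws are used below.
module RingFacts {c ℓ : Level} (K : CommutativeRing c ℓ) where
  open CommutativeRing K
  open import Algebra.Properties.Semiring.Sum semiring public
    using (sum; sum-cong-≋; ∑-comm; *-distribˡ-sum; *-distribʳ-sum; sum-init-last; sum-replicate)
  open import Algebra.Properties.Semiring.Exp semiring public
    using (_^_; ^-homo-*; ^-assocʳ; ^-congˡ)
  open import Algebra.Properties.Semiring.Mult semiring
    using (×1-homo-*) renaming (_×_ to _×ₖ_)
  open MonoidSum +-commutativeMonoid public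
  open import Algebra.Properties.Ring ring using ([y-z]x≈yx-zx)
  open import Algebra.Properties.Group +-group using (x∙y⁻¹≈ε⇒x≈y; quasigroup)
  open import Algebra.Properties.Quasigroup quasigroup using (cancelˡ)
  open import Relation.Binary.Reasoning.Setoid setoid

  powK≡^ : ∀ x k → powK K x k ≡ x ^ k
  powK≡^ x zero    = ≡.refl
  powK≡^ x (suc k) = ≡.cong (x *_) (powK≡^ x k)

  ι : ℕ → Carrier
  ι k = k ×ₖ 1#

  natK≡ι : ∀ k → natK K k ≡ ι k
  natK≡ι zero    = ≡.refl
  natK≡ι (suc k) = ≡.cong (1# +_) (natK≡ι k)

  ι-* : ∀ a b → ι (a ℕ.* b) ≈ ι a * ι b
  ι-* = ×1-homo-*

  sumK≡sum : ∀ {m} (f : Fin m → Carrier) → sumK K f ≡ sum f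
  sumK≡sum {zero}  f = ≡.refl
  sumK≡sum {suc m} f = ≡.cong (f Fin.zero +_) (sumK≡sum (λ i → f (Fin.suc i)))

  1^ : ∀ k → 1# ^ k ≈ 1#
  1^ zero    = refl
  1^ (suc k) = trans (*-identityˡ _) (1^ k)

  geometric : ℕ → Carrier → Carrier
  geometric m x = sum {m} (λ j → x ^ toℕ j)

  geometric-one : ∀ m x → x ≈ 1# → geometric m x ≈ ι m
  geometric-one m x x≈1 = trans (sum-cong-≋ {m} (λ j → trans (^-congˡ (toℕ j) x≈1) (1^ (toℕ j))))
                                (sum-replicate m)

  geometric-shift : ∀ m x → 1# + x * geometric m x ≈ geometric m x + x ^ m
  geometric-shift m x = begin
    1# + x * geometric m x                    ≈⟨ +-congˡ (*-distribˡ-sum {m} x (λ j → x ^ toℕ j)) ⟩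
    geometric (suc m) x                       ≈⟨ sum-init-last {m} (λ j → x ^ toℕ j) ⟩
    sum {m} (λ j → x ^ toℕ (Fin.inject₁ j)) + x ^ toℕ (Fin.fromℕ m)
      ≈⟨ +-cong (sum-cong-≋ {m} (λ j → reflexive (≡.cong (x ^_) (FinP.toℕ-inject₁ j))))
                (reflexive (≡.cong (x ^_) (FinP.toℕ-fromℕ m))) ⟩
    geometric m x + x ^ m                     ∎

  no-zero-divisors : IsField K → ∀ z y → ¬ (z ≈ 0#) → z * y ≈ 0# → y ≈ 0#
  no-zero-divisors (_ , inverse) z y z≉0 zy≈0 with inverse z z≉0
  ... | z⁻¹ , zz⁻¹≈1 = begin
    y               ≈⟨ sym (*-identityˡ y) ⟩
    1# * y          ≈⟨ *-congʳ (trans (sym zz⁻¹≈1) (*-comm z z⁻¹)) ⟩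
    (z⁻¹ * z) * y   ≈⟨ *-assoc z⁻¹ z y ⟩
    z⁻¹ * (z * y)   ≈⟨ *-congˡ zy≈0 ⟩
    z⁻¹ * 0#        ≈⟨ zeroʳ z⁻¹ ⟩
    0#              ∎

  -- A root of unity x ≠ 1 has vanishing geometric sum: the shift gives
  -- x·G = G, hence (x - 1)·G = 0 with x - 1 ≠ 0.
  geometric-vanishes : IsField K → ∀ m x → x ^ m ≈ 1# → ¬ (x ≈ 1#) → geometric m x ≈ 0#
  geometric-vanishes fld m x xᵐ≈1 x≉1 =
    no-zero-divisors fld (x - 1#) G (λ x-1≈0 → x≉1 (x∙y⁻¹≈ε⇒x≈y x 1# x-1≈0)) (begin
      (x - 1#) * G    ≈⟨ [y-z]x≈yx-zx G x 1# ⟩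
      x * G - 1# * G  ≈⟨ +-cong xG≈G (-‿cong (*-identityˡ G)) ⟩
      G - G           ≈⟨ -‿inverseʳ G ⟩
      0#              ∎)
    where
    G = geometric m x
    xG≈G : x * G ≈ G
    xG≈G = cancelˡ 1# (x * G) G
      (trans (geometric-shift m x) (trans (+-congˡ xᵐ≈1) (+-comm G 1#)))

  ι-suc≉0 : CharZero K → ∀ k → ¬ (ι (suc k) ≈ 0#)
  ι-suc≉0 cz k eq = cz k (trans (reflexive (natK≡ι (suc k))) eq)

  ι-injective : CharZero K → ∀ a b → ι a ≈ ι b → a ≡ b
  ι-injective cz zero    zero    _  = ≡.refl
  ι-injective cz zero    (suc b) eq = ⊥-elim (ι-suc≉0 cz b (sym eq))
  ι-injective cz (suc a) zero    eq = ⊥-elim (ι-suc≉0 cz a eq)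
  ι-injective cz (suc a) (suc b) eq = ≡.cong suc (ι-injective cz a b (cancelˡ 1# (ι a) (ι b) eq))

  primitive-divisor : ∀ {e} d m ζ → 1 ≤ d → e ≡ d ℕ.* m →
                      IsPrimitiveRoot K e ζ → IsPrimitiveRoot K m (powK K ζ d)
  primitive-divisor d m ζ 1≤d e≡dm (ζᵉ≈1 , ζᵏ≉1) = root , nontrivial
    where
    instance
      d≢0 : ℕ.NonZero d
      d≢0 = ℕ.>-nonZero 1≤d
    power : ∀ k → powK K (powK K ζ d) k ≈ powK K ζ (d ℕ.* k)
    power k = begin
      powK K (powK K ζ d) k  ≡⟨ ≡.trans (powK≡^ (powK K ζ d) k) (≡.cong (_^ k) (powK≡^ ζ d)) ⟩
      (ζ ^ d) ^ k            ≈⟨ ^-assocʳ ζ d k ⟩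
      ζ ^ (d ℕ.* k)          ≡⟨ powK≡^ ζ (d ℕ.* k) ⟨
      powK K ζ (d ℕ.* k)     ∎
    root : powK K (powK K ζ d) m ≈ 1#
    root = trans (power m) (trans (reflexive (≡.cong (powK K ζ) (≡.sym e≡dm))) ζᵉ≈1)
    nontrivial : ∀ k → 1 ≤ k → k < m → ¬ (powK K (powK K ζ d) k ≈ 1#)
    nontrivial k 1≤k k<m eq = ζᵏ≉1 (d ℕ.* k) (ℕP.*-mono-≤ 1≤d 1≤k)
      (≡.subst (d ℕ.* k <_) (≡.sym e≡dm) (ℕP.*-monoʳ-< d k<m)) (trans (sym (power k)) eq)

-- The characters of the
-- cyclic group of order m are k ↦ (ω^k)^i for i < m.  They are
-- orthogonal, which yields Fourier inversion: the coefficients of a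
-- function in the basis of characters are determined by the function.
module RootsOfUnity {c ℓ : Level} (K : CommutativeRing c ℓ) (fld : IsField K)
                    (m : ℕ) (ω : CommutativeRing.Carrier K) (prim : IsPrimitiveRoot K m ω) where
  open CommutativeRing K
  open RingFacts K
  open import Relation.Binary.Reasoning.Setoid setoid

  ω^m≈1 : ω ^ m ≈ 1#
  ω^m≈1 = trans (reflexive (≡.sym (powK≡^ ω m))) (proj₁ prim)

  ω^k≉1 : ∀ k → 1 ≤ k → k < m → ¬ (ω ^ k ≈ 1#)
  ω^k≉1 k 1≤k k<m eq = proj₂ prim k 1≤k k<m (trans (reflexive (powK≡^ ω k)) eq)

  root-of-unity : ∀ t → (ω ^ t) ^ m ≈ 1#
  root-of-unity t = begin
    (ω ^ t) ^ m    ≈⟨ ^-assocʳ ω t m ⟩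
    ω ^ (t ℕ.* m)  ≡⟨ ≡.cong (ω ^_) (ℕP.*-comm t m) ⟩
    ω ^ (m ℕ.* t)  ≈⟨ ^-assocʳ ω m t ⟨
    (ω ^ m) ^ t    ≈⟨ ^-congˡ t ω^m≈1 ⟩
    1# ^ t         ≈⟨ 1^ t ⟩
    1#             ∎

  shifted-≉1 : ∀ i j → i < m → j < m → i ≢ j → ¬ (ω ^ (i ℕ.+ (m ∸ j)) ≈ 1#)
  shifted-≉1 i j i<m j<m i≢j with ℕP.<-cmp i j
  ... | tri≈ _ i≡j _ = ⊥-elim (i≢j i≡j)
  ... | tri< i<j _ _ = ω^k≉1 (i ℕ.+ (m ∸ j))
          (ℕP.≤-trans (ℕP.m<n⇒0<n∸m j<m) (ℕP.m≤n+m (m ∸ j) i))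
          (ℕP.<-≤-trans (ℕP.+-monoˡ-< (m ∸ j) i<j)
                        (ℕP.≤-reflexive (ℕP.m+[n∸m]≡n (ℕP.<⇒≤ j<m))))
  ... | tri> _ _ j<i = λ eq →
        ω^k≉1 (i ∸ j) (ℕP.m<n⇒0<n∸m j<i) (ℕP.≤-<-trans (ℕP.m∸n≤m i j) i<m) (begin
          ω ^ (i ∸ j)            ≈⟨ *-identityʳ _ ⟨
          ω ^ (i ∸ j) * 1#       ≈⟨ *-congˡ ω^m≈1 ⟨
          ω ^ (i ∸ j) * ω ^ m    ≈⟨ ^-homo-* ω (i ∸ j) m ⟨
          ω ^ (i ∸ j ℕ.+ m)      ≡⟨ ≡.cong (ω ^_) reassociate ⟩
          ω ^ (i ℕ.+ (m ∸ j))    ≈⟨ eq ⟩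
          1#                     ∎)
    where
    reassociate : i ∸ j ℕ.+ m ≡ i ℕ.+ (m ∸ j)
    reassociate = ≡.trans (≡.sym (ℕP.+-∸-comm m (ℕP.<⇒≤ j<i))) (ℕP.+-∸-assoc i (ℕP.<⇒≤ j<m))

  character-sum : ∀ k → 1 ≤ k → k < m → geometric m (ω ^ k) ≈ 0#
  character-sum k 1≤k k<m = geometric-vanishes fld m (ω ^ k) (root-of-unity k) (ω^k≉1 k 1≤k k<m)

  character-product : ∀ k i j → (ω ^ k) ^ i * (ω ^ k) ^ j ≈ (ω ^ (i ℕ.+ j)) ^ k
  character-product k i j = begin
    (ω ^ k) ^ i * (ω ^ k) ^ j   ≈⟨ ^-homo-* (ω ^ k) i j ⟨
    (ω ^ k) ^ (i ℕ.+ j)         ≈⟨ ^-assocʳ ω k (i ℕ.+ j) ⟩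
    ω ^ (k ℕ.* (i ℕ.+ j))       ≡⟨ ≡.cong (ω ^_) (ℕP.*-comm k (i ℕ.+ j)) ⟩
    ω ^ ((i ℕ.+ j) ℕ.* k)       ≈⟨ ^-assocʳ ω (i ℕ.+ j) k ⟨
    (ω ^ (i ℕ.+ j)) ^ k         ∎

  -- The inner product of character i with the inverse of character j.
  inner : Fin m → Fin m → Carrier
  inner i j = sum {m} (λ k → (ω ^ toℕ k) ^ toℕ i * (ω ^ toℕ k) ^ (m ∸ toℕ j))

  inner-geometric : ∀ i j → inner i j ≈ geometric m (ω ^ (toℕ i ℕ.+ (m ∸ toℕ j)))
  inner-geometric i j = sum-cong-≋ {m} (λ k → character-product (toℕ k) (toℕ i) (m ∸ toℕ j))

  orthogonal-same : ∀ j → inner j j ≈ ι m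
  orthogonal-same j = trans (inner-geometric j j) (geometric-one m _ (begin
    ω ^ (toℕ j ℕ.+ (m ∸ toℕ j))  ≡⟨ ≡.cong (ω ^_) (ℕP.m+[n∸m]≡n (ℕP.<⇒≤ (FinP.toℕ<n j))) ⟩
    ω ^ m                        ≈⟨ ω^m≈1 ⟩
    1#                           ∎))

  orthogonal-distinct : ∀ i j → i ≢ j → inner i j ≈ 0#
  orthogonal-distinct i j i≢j = trans (inner-geometric i j)
    (geometric-vanishes fld m _ (root-of-unity (toℕ i ℕ.+ (m ∸ toℕ j)))
      (shifted-≉1 (toℕ i) (toℕ j) (FinP.toℕ<n i) (FinP.toℕ<n j) (i≢j ∘ FinP.toℕ-injective)))

  fourier-inversion : (A f : Fin m → Carrier) →
    (∀ k → f k ≈ sum (λ i → A i * (ω ^ toℕ k) ^ toℕ i)) →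
    ∀ j → sum (λ k → f k * (ω ^ toℕ k) ^ (m ∸ toℕ j)) ≈ A j * ι m
  fourier-inversion A f expand j = begin
    sum (λ k → f k * W k)
      ≈⟨ sum-cong-≋ {m} (λ k → *-congʳ (expand k)) ⟩
    sum (λ k → sum (λ i → A i * X k i) * W k)
      ≈⟨ sum-cong-≋ {m} (λ k → *-distribʳ-sum {m} (W k) (λ i → A i * X k i)) ⟩
    sum (λ k → sum (λ i → A i * X k i * W k))
      ≈⟨ sum-cong-≋ {m} (λ k → sum-cong-≋ {m} (λ i → *-assoc (A i) (X k i) (W k))) ⟩
    sum (λ k → sum (λ i → A i * (X k i * W k)))
      ≈⟨ ∑-comm {m} {m} (λ k i → A i * (X k i * W k)) ⟩
    sum (λ i → sum (λ k → A i * (X k i * W k)))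
      ≈⟨ sum-cong-≋ {m} (λ i → *-distribˡ-sum {m} (A i) (λ k → X k i * W k)) ⟨
    sum {m} (λ i → A i * inner i j)
      ≈⟨ sum-δ (λ i → A i * inner i j) j off-diagonal ⟩
    A j * inner j j
      ≈⟨ *-congˡ (orthogonal-same j) ⟩
    A j * ι m
      ∎
    where
    X : Fin m → Fin m → Carrier
    X k i = (ω ^ toℕ k) ^ toℕ i
    W : Fin m → Carrier
    W k = (ω ^ toℕ k) ^ (m ∸ toℕ j)
    off-diagonal : ∀ i → i ≢ j → A i * inner i j ≈ 0#
    off-diagonal i i≢j = trans (*-congˡ (orthogonal-distinct i j i≢j)) (zeroʳ (A i))

-- Arithmetic of the fractions frac a b = a/b, reduced to cross
-- multiplication of natural numbers through unnormalised rationals.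
module Fractions where
  open import Data.Rational as ℚ using (ℚ; 0ℚ)
  import Data.Rational.Properties as ℚP
  open import Data.Rational.Unnormalised as ℚᵘ using (mkℚᵘ; *≡*)
  import Data.Rational.Unnormalised.Properties as ℚᵘP
  open import Data.Integer as ℤ using (+_)
  import Data.Integer.Properties as ℤP
  open import Data.Nat.Tactic.RingSolver using (solve-∀)
  open NatSum using (sum)
  open ≡-Reasoning

  frac-from-ℚᵘ : ∀ p a b → ℚ.toℚᵘ p ℚᵘ.≃ mkℚᵘ (+ a) b → p ≡ frac a (suc b)
  frac-from-ℚᵘ p a b p≃a/b = ≡.trans (≡.sym (ℚP.fromℚᵘ-toℚᵘ p)) (ℚP.fromℚᵘ-cong p≃a/b)

  frac-to-ℚᵘ : ∀ a b → ℚ.toℚᵘ (frac a (suc b)) ℚᵘ.≃ mkℚᵘ (+ a) b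
  frac-to-ℚᵘ a b = ℚP.toℚᵘ-fromℚᵘ (mkℚᵘ (+ a) b)

  frac-cross : ∀ a b c d → a ℕ.* suc d ≡ c ℕ.* suc b → frac a (suc b) ≡ frac c (suc d)
  frac-cross a b c d eq = ℚP.fromℚᵘ-cong {mkℚᵘ (+ a) b} {mkℚᵘ (+ c) d} (*≡* (begin
    + a ℤ.* + suc d    ≡⟨ ℤP.pos-* a (suc d) ⟨
    + (a ℕ.* suc d)    ≡⟨ ≡.cong +_ eq ⟩
    + (c ℕ.* suc b)    ≡⟨ ℤP.pos-* c (suc b) ⟩
    + c ℤ.* + suc b    ∎))

  frac-* : ∀ a b c d → frac a (suc b) ℚ.* frac c (suc d) ≡ frac (a ℕ.* c) (suc b ℕ.* suc d)
  frac-* a b c d = frac-from-ℚᵘ _ (a ℕ.* c) _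
    (ℚᵘP.≃-trans (ℚP.toℚᵘ-homo-* (frac a (suc b)) (frac c (suc d)))
      (ℚᵘP.≃-trans (ℚᵘP.*-cong (frac-to-ℚᵘ a b) (frac-to-ℚᵘ c d))
        (ℚᵘP.≃-reflexive (≡.cong (λ z → mkℚᵘ z _) (≡.sym (ℤP.pos-* a c))))))

  frac-+ : ∀ a c b → frac a (suc b) ℚ.+ frac c (suc b) ≡ frac (a ℕ.+ c) (suc b)
  frac-+ a c b = frac-from-ℚᵘ _ (a ℕ.+ c) b
    (ℚᵘP.≃-trans (ℚP.toℚᵘ-homo-+ (frac a (suc b)) (frac c (suc b)))
      (ℚᵘP.≃-trans (ℚᵘP.+-cong (frac-to-ℚᵘ a b) (frac-to-ℚᵘ c b)) (*≡* (begin
        (+ a ℤ.* + suc b ℤ.+ + c ℤ.* + suc b) ℤ.* + suc b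
          ≡⟨ regroup (+ a) (+ c) (+ suc b) ⟩
        (+ a ℤ.+ + c) ℤ.* (+ suc b ℤ.* + suc b)
          ≡⟨ ≡.cong₂ ℤ._*_ (ℤP.pos-+ a c) (ℤP.pos-* (suc b) (suc b)) ⟨
        + (a ℕ.+ c) ℤ.* + (suc b ℕ.* suc b)
          ∎))))
    where
    open import Data.Integer.Tactic.RingSolver using () renaming (solve-∀ to solve-∀ℤ)
    regroup : ∀ x y z → (x ℤ.* z ℤ.+ y ℤ.* z) ℤ.* z ≡ (x ℤ.+ y) ℤ.* (z ℤ.* z)
    regroup = solve-∀ℤ

  sumℚ-cong : ∀ {k} {f g : Fin k → ℚ} → (∀ j → f j ≡ g j) → sumℚ f ≡ sumℚ g
  sumℚ-cong {zero}  f≡g = ≡.refl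
  sumℚ-cong {suc k} f≡g = ≡.cong₂ ℚ._+_ (f≡g Fin.zero) (sumℚ-cong (f≡g ∘ Fin.suc))

  sumℚ-frac : ∀ {k} b (f : Fin k → ℚ) (g : Fin k → ℕ) →
              (∀ j → f j ≡ frac (g j) (suc b)) → sumℚ f ≡ frac (sum g) (suc b)
  sumℚ-frac {zero}  b f g f≡g = ≡.sym (ℚP.0/n≡0 (suc b))
  sumℚ-frac {suc k} b f g f≡g = ≡.trans
    (≡.cong₂ ℚ._+_ (f≡g Fin.zero) (sumℚ-frac b (f ∘ Fin.suc) (g ∘ Fin.suc) (f≡g ∘ Fin.suc)))
    (frac-+ (g Fin.zero) (sum (g ∘ Fin.suc)) b)

  triangle : ∀ m → 2 ℕ.* sum {suc m} toℕ ≡ suc m ℕ.* m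
  triangle zero    = ≡.refl
  triangle (suc m) = begin
    2 ℕ.* sum {suc (suc m)} toℕ
      ≡⟨ ≡.cong (2 ℕ.*_) (NatSum.sum-init-last {suc m} toℕ) ⟩
    2 ℕ.* (sum {suc m} (toℕ ∘ Fin.inject₁) ℕ.+ toℕ (Fin.fromℕ (suc m)))
      ≡⟨ ≡.cong₂ (λ t l → 2 ℕ.* (t ℕ.+ l))
                 (NatSum.sum-cong-≋ {suc m} FinP.toℕ-inject₁) (FinP.toℕ-fromℕ (suc m)) ⟩
    2 ℕ.* (sum {suc m} toℕ ℕ.+ suc m)
      ≡⟨ ℕP.*-distribˡ-+ 2 (sum {suc m} toℕ) (suc m) ⟩
    2 ℕ.* sum {suc m} toℕ ℕ.+ 2 ℕ.* suc m
      ≡⟨ ≡.cong (ℕ._+ 2 ℕ.* suc m) (triangle m) ⟩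
    suc m ℕ.* m ℕ.+ 2 ℕ.* suc m
      ≡⟨ step m ⟩
    suc (suc m) ℕ.* suc m
      ∎
    where
    step : ∀ m → suc m ℕ.* m ℕ.+ 2 ℕ.* suc m ≡ suc (suc m) ℕ.* suc m
    step = solve-∀

  pairing-value : ∀ c m′ n → n ≡ c ℕ.* suc m′ →
    sumℚ {suc m′} (λ j → frac c 1 ℚ.* frac (toℕ j) (suc m′))
      ≡ frac n (suc m′) ℚ.* frac m′ 2
  pairing-value c m′ n n≡cm = begin
    sumℚ {m} (λ j → frac c 1 ℚ.* frac (toℕ j) m)
      ≡⟨ sumℚ-frac {m} m′ _ (λ j → c ℕ.* toℕ j) (scale ∘ toℕ) ⟩
    frac (sum {m} (λ j → c ℕ.* toℕ j)) m
      ≡⟨ frac-cross (sum {m} (λ j → c ℕ.* toℕ j)) m′ (n ℕ.* m′) (suc (m′ ℕ.* 2)) cross ⟩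
    frac (n ℕ.* m′) (m ℕ.* 2)
      ≡⟨ frac-* n m′ m′ 1 ⟨
    frac n m ℚ.* frac m′ 2
      ∎
    where
    m = suc m′
    scale : ∀ j → frac c 1 ℚ.* frac j m ≡ frac (c ℕ.* j) m
    scale j = ≡.trans (frac-* c 0 j m′) (frac-cross (c ℕ.* j) (m′ ℕ.+ 0) (c ℕ.* j) m′
      (≡.cong (λ k → c ℕ.* j ℕ.* suc k) (≡.sym (ℕP.+-identityʳ m′))))
    T = sum {m} toℕ
    regroup₁ : ∀ c T m → c ℕ.* T ℕ.* (m ℕ.* 2) ≡ c ℕ.* m ℕ.* (2 ℕ.* T)
    regroup₁ = solve-∀
    regroup₂ : ∀ c m m′ → c ℕ.* m ℕ.* (m ℕ.* m′) ≡ c ℕ.* m ℕ.* m′ ℕ.* m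
    regroup₂ = solve-∀
    cross : sum {m} (λ j → c ℕ.* toℕ j) ℕ.* (m ℕ.* 2) ≡ n ℕ.* m′ ℕ.* m
    cross = begin
      sum {m} (λ j → c ℕ.* toℕ j) ℕ.* (m ℕ.* 2)
        ≡⟨ ≡.cong (ℕ._* (m ℕ.* 2)) (NatSum.*-distribˡ-sum {m} c toℕ) ⟨
      c ℕ.* T ℕ.* (m ℕ.* 2)   ≡⟨ regroup₁ c T m ⟩
      c ℕ.* m ℕ.* (2 ℕ.* T)   ≡⟨ ≡.cong (c ℕ.* m ℕ.*_) (triangle m′) ⟩
      c ℕ.* m ℕ.* (m ℕ.* m′)  ≡⟨ regroup₂ c m m′ ⟩
      c ℕ.* m ℕ.* m′ ℕ.* m    ≡⟨ ≡.cong (λ k → k ℕ.* m′ ℕ.* m) n≡cm ⟨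
      n ℕ.* m′ ℕ.* m          ∎

  frac-cancel : ∀ n e m → 1 ≤ e → 1 ≤ m → frac n e ℚ.* frac e m ≡ frac n m
  frac-cancel n (suc e′) (suc m′) _ _ = ≡.trans (frac-* n e′ (suc e′) m′)
    (frac-cross (n ℕ.* suc e′) _ n m′ (ℕP.*-assoc n (suc e′) (suc m′)))

-- Coefficients in the group algebra ℚG: in ∑_{m ∣ e} q(m) ∑_{|s| = m} s
-- the coefficient of t is q(|t|), since only the divisor m = |t| contributes.
module GroupAlgebra where
  open import Data.Rational as ℚ using (ℚ; 0ℚ; 1ℚ)
  import Data.Rational.Properties as ℚP
  open import Data.Bool using (if_then_else_)
  open import Data.Nat.Divisibility using (_∣?_; ∣⇒≤)

  sumRange-zero : ∀ e f → (∀ k → k ≤ e → f k ≡ 0ℚ) → sumRange e f ≡ 0ℚ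
  sumRange-zero zero    f f≡0 = ≡.refl
  sumRange-zero (suc e) f f≡0 =
    ≡.cong₂ ℚ._+_ (sumRange-zero e f (λ k k≤e → f≡0 k (ℕP.m≤n⇒m≤1+n k≤e))) (f≡0 (suc e) ℕP.≤-refl)

  sumRange-δ : ∀ e f m → 1 ≤ m → m ≤ e → (∀ k → k ≢ m → f k ≡ 0ℚ) → sumRange e f ≡ f m
  sumRange-δ zero    f m 1≤m m≤0   f≡0 = ⊥-elim (ℕP.<⇒≱ 1≤m m≤0)
  sumRange-δ (suc e) f m 1≤m m≤1+e f≡0 with ℕP.m≤n⇒m<n∨m≡n m≤1+e
  ... | inj₁ m<1+e = ≡.trans
    (≡.cong₂ ℚ._+_ (sumRange-δ e f m 1≤m (ℕP.≤-pred m<1+e) f≡0) (f≡0 (suc e) (ℕP.>⇒≢ m<1+e)))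
    (ℚP.+-identityʳ (f m))
  ... | inj₂ ≡.refl = ≡.trans
    (≡.cong (ℚ._+ f (suc e)) (sumRange-zero e f (λ k k≤e → f≡0 k (ℕP.<⇒≢ (s≤s k≤e)))))
    (ℚP.+-identityˡ (f (suc e)))

  elemsOfOrder-same : ∀ {n} (ord : Fin n → ℕ) t → elemsOfOrder ord (ord t) t ≡ 1ℚ
  elemsOfOrder-same ord t =
    ≡.cong (λ b → if b then 1ℚ else 0ℚ) (dec-true (ord t ℕ.≟ ord t) ≡.refl)

  elemsOfOrder-other : ∀ {n} (ord : Fin n → ℕ) t k → ord t ≢ k → elemsOfOrder ord k t ≡ 0ℚ
  elemsOfOrder-other ord t k ord≢k =
    ≡.cong (λ b → if b then 1ℚ else 0ℚ) (dec-false (ord t ℕ.≟ k) ord≢k)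

  coefficient : ∀ {n} (ord : Fin n → ℕ) e (q : ℕ → ℚ) t → 1 ≤ e → 1 ≤ ord t → ord t ∣ e →
                sumDiv e (λ m → q m · elemsOfOrder ord m) t ≡ q (ord t)
  coefficient ord e q t 1≤e 1≤ord ord∣e =
    ≡.trans (sumRange-δ e term (ord t) 1≤ord (∣⇒≤ {{ℕ.>-nonZero 1≤e}} ord∣e) vanish) at-order
    where
    term : ℕ → ℚ
    term m = if does (m ∣? e) then q m ℚ.* elemsOfOrder ord m t else 0ℚ
    vanish : ∀ k → k ≢ ord t → term k ≡ 0ℚ
    vanish k k≢ord with k ∣? e
    ... | yes _ = ≡.trans (≡.cong (q k ℚ.*_) (elemsOfOrder-other ord t k (k≢ord ∘ ≡.sym)))
                          (ℚP.*-zeroʳ (q k))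
    ... | no _  = ≡.refl
    at-order : term (ord t) ≡ q (ord t)
    at-order with ord t ∣? e
    ... | yes _ = ≡.trans (≡.cong (q (ord t) ℚ.*_) (elemsOfOrder-same ord t))
                          (ℚP.*-identityʳ (q (ord t)))
    ... | no ∤  = ⊥-elim (∤ ord∣e)

module RegularPairing {c ℓ : Level} (K : CommutativeRing c ℓ) (fld : IsField K) (cz : CharZero K)
    {n : ℕ} (G : FinGroup n) (e : ℕ) (exponent : IsExponent G e)
    (ζ : CommutativeRing.Carrier K) (prim : IsPrimitiveRoot K e ζ) where
  open import Data.Rational as ℚ using (ℚ)
  open CommutativeRing K
  open RingFacts K
  open FinGroup G using (ε)
  open GroupFacts G
  open import Relation.Binary.Reasoning.Setoid setoid

  χ : Fin n → Carrier
  χ = regChar K G e ζ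

  module AtElement (s : Fin n) (m′ : ℕ) (order : IsOrder G s (suc m′)) where
    open Cyclic s (suc m′) order using (order-divides)
    open Lagrange G s m′ order using (m; lagrange)

    m∣e : m ∣ e
    m∣e = order-divides e (proj₁ (proj₂ exponent) s)

    d : ℕ
    d = e / m

    e≡dm : e ≡ d ℕ.* m
    e≡dm = ≡.sym (m/n*n≡m m∣e)

    1≤d : 1 ≤ d
    1≤d = ℕP.n≢0⇒n>0 (λ d≡0 →
      ℕP.<⇒≢ (proj₁ exponent) (≡.sym (≡.trans e≡dm (≡.cong (ℕ._* m) d≡0))))

    ω : Carrier
    ω = powK K ζ d

    open RootsOfUnity K fld m ω (primitive-divisor d m ζ 1≤d e≡dm prim)

    c′ : ℕ
    c′ = quotient lagrange

    n≡c′m : n ≡ c′ ℕ.* m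
    n≡c′m = m∣n⇒n≡quotient*m lagrange

    χ-ε : χ (pow G s 0) ≈ ι n
    χ-ε = reflexive (≡.trans (≡.cong (natK K) regFix-ε) (natK≡ι n))

    χ-nontrivial : ∀ k → 1 ≤ k → k < m → χ (pow G s k) ≈ 0#
    χ-nontrivial k 1≤k k<m =
      reflexive (≡.cong (natK K) (regFix-≢ε (pow G s k) (proj₂ (proj₂ order) k 1≤k k<m)))

    linChar≈ : ∀ j k → linChar K G e ζ m j k ≈ (ω ^ k) ^ toℕ j
    linChar≈ j k = begin
      powK K ζ (d ℕ.* toℕ j ℕ.* k)  ≡⟨ powK≡^ ζ (d ℕ.* toℕ j ℕ.* k) ⟩
      ζ ^ (d ℕ.* toℕ j ℕ.* k)        ≡⟨ ≡.cong (ζ ^_) (reorder d (toℕ j) k) ⟩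
      ζ ^ (d ℕ.* (k ℕ.* toℕ j))      ≈⟨ ^-assocʳ ζ d (k ℕ.* toℕ j) ⟨
      (ζ ^ d) ^ (k ℕ.* toℕ j)        ≈⟨ ^-assocʳ (ζ ^ d) k (toℕ j) ⟨
      ((ζ ^ d) ^ k) ^ toℕ j          ≡⟨ ≡.cong (λ x → (x ^ k) ^ toℕ j) (powK≡^ ζ d) ⟨
      (ω ^ k) ^ toℕ j                ∎
      where
      reorder : ∀ d j k → d ℕ.* j ℕ.* k ≡ d ℕ.* (k ℕ.* j)
      reorder = solve-∀
        where open import Data.Nat.Tactic.RingSolver using (solve-∀)

    combination : (Fin m → ℕ) → ℕ → Carrier
    combination a k = sumK K (λ j → natK K (a j) * linChar K G e ζ m j k)

    combination≈ : ∀ a k → combination a k ≈ sum {m} (λ j → ι (a j) * (ω ^ k) ^ toℕ j)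
    combination≈ a k = trans (reflexive (sumK≡sum {m} (λ j → natK K (a j) * linChar K G e ζ m j k)))
      (sum-cong-≋ {m} (λ j → *-cong (reflexive (natK≡ι (a j))) (linChar≈ j k)))

    decomposition : ∀ k → k < m → χ (pow G s k) ≈ combination (λ _ → c′) k
    decomposition k k<m = sym (begin
      combination (λ _ → c′) k                ≈⟨ combination≈ (λ _ → c′) k ⟩
      sum {m} (λ j → ι c′ * (ω ^ k) ^ toℕ j)  ≈⟨ *-distribˡ-sum {m} (ι c′) (λ j → (ω ^ k) ^ toℕ j) ⟨
      ι c′ * geometric m (ω ^ k)              ≈⟨ values k k<m ⟩
      χ (pow G s k)                           ∎)
      where
      values : ∀ k → k < m → ι c′ * geometric m (ω ^ k) ≈ χ (pow G s k)
      values zero    _   = begin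
        ι c′ * geometric m 1#  ≈⟨ *-congˡ (geometric-one m 1# refl) ⟩
        ι c′ * ι m             ≈⟨ ι-* c′ m ⟨
        ι (c′ ℕ.* m)           ≡⟨ ≡.cong ι n≡c′m ⟨
        ι n                    ≈⟨ χ-ε ⟨
        χ (pow G s 0)          ∎
      values (suc k) k<m = begin
        ι c′ * geometric m (ω ^ suc k)  ≈⟨ *-congˡ (character-sum (suc k) (s≤s z≤n) k<m) ⟩
        ι c′ * 0#                       ≈⟨ zeroʳ (ι c′) ⟩
        0#                              ≈⟨ χ-nontrivial (suc k) (s≤s z≤n) k<m ⟨
        χ (pow G s (suc k))             ∎

    multiplicity : (a : Fin m → ℕ) → (∀ k → k < m → χ (pow G s k) ≈ combination a k) →
                   ∀ j → a j ≡ c′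
    multiplicity a decomposes j = ℕP.*-cancelʳ-≡ (a j) c′ m (ι-injective cz _ _ (begin
      ι (a j ℕ.* m)                 ≈⟨ ι-* (a j) m ⟩
      ι (a j) * ι m                 ≈⟨ fourier-inversion (ι ∘ a) χₛ expand j ⟨
      sum {m} (λ k → χₛ k * W k)    ≈⟨ sum-δ (λ k → χₛ k * W k) Fin.zero only-ε ⟩
      χₛ Fin.zero * W Fin.zero      ≈⟨ *-cong χ-ε (1^ (m ∸ toℕ j)) ⟩
      ι n * 1#                      ≈⟨ *-identityʳ (ι n) ⟩
      ι n                           ≡⟨ ≡.cong ι n≡c′m ⟩
      ι (c′ ℕ.* m)                  ∎))
      where
      χₛ : Fin m → Carrier
      χₛ k = χ (pow G s (toℕ k))
      expand : ∀ k → χₛ k ≈ sum {m} (λ i → ι (a i) * (ω ^ toℕ k) ^ toℕ i)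
      expand k = trans (decomposes (toℕ k) (FinP.toℕ<n k)) (combination≈ a (toℕ k))
      W : Fin m → Carrier
      W k = (ω ^ toℕ k) ^ (m ∸ toℕ j)
      only-ε : ∀ k → k ≢ Fin.zero → χₛ k * W k ≈ 0#
      only-ε Fin.zero      k≢0 = ⊥-elim (k≢0 ≡.refl)
      only-ε (Fin.suc k) _   = trans
        (*-congʳ (χ-nontrivial (suc (toℕ k)) (s≤s z≤n) (FinP.toℕ<n (Fin.suc k)))) (zeroˡ _)

    value : sumℚ {m} (λ j → frac c′ 1 ℚ.* frac (toℕ j) m) ≡ frac n m ℚ.* frac m′ 2
    value = Fractions.pairing-value c′ m′ n n≡c′m

    pairing : ∀ q → IsPairing K G e ζ χ s m q ⇔ (q ≡ frac n m ℚ.* frac m′ 2)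
    pairing q = mk⇔
      (λ (a , decomposes , q≡) → ≡.trans q≡ (≡.trans (Fractions.sumℚ-cong (λ j →
        ≡.cong (λ x → frac x 1 ℚ.* frac (toℕ j) m) (multiplicity a decomposes j))) value))
      (λ q≡ → (λ _ → c′) , decomposition , ≡.trans q≡ (≡.sym value))

  regular-pairing : ∀ s m → IsOrder G s m → ∀ q →
                    IsPairing K G e ζ χ s m q ⇔ (q ≡ frac n m ℚ.* frac (m ∸ 1) 2)
  regular-pairing s (suc m′) order = AtElement.pairing s m′ order

module StatementCoefficients {n : ℕ} (G : FinGroup n) (e : ℕ) (exponent : IsExponent G e)
    (ord : Fin n → ℕ) (orders : ∀ s → IsOrder G s (ord s)) where
  open import Data.Rational as ℚ using (ℚ)
  import Data.Rational.Properties as ℚP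
  open ≡-Reasoning

  angle : ℕ → ℚ
  angle m = frac n m ℚ.* frac (m ∸ 1) 2

  scaled : QG n
  scaled = frac n e · sumDiv e (λ m → (frac e m ℚ.* frac (m ∸ 1) 2) · elemsOfOrder ord m)

  direct : QG n
  direct = sumDiv e (λ m → angle m · elemsOfOrder ord m)

  1≤e : 1 ≤ e
  1≤e = proj₁ exponent

  ord∣e : ∀ t → ord t ∣ e
  ord∣e t = GroupFacts.Cyclic.order-divides G t (ord t) (orders t) e (proj₁ (proj₂ exponent) t)

  scaled-coefficient : ∀ t → scaled t ≡ angle (ord t)
  scaled-coefficient t = begin
    frac n e ℚ.* sumDiv e (λ m → q m · elemsOfOrder ord m) t
      ≡⟨ ≡.cong (frac n e ℚ.*_) (GroupAlgebra.coefficient ord e q t 1≤e (proj₁ (orders t)) (ord∣e t)) ⟩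
    frac n e ℚ.* (frac e (ord t) ℚ.* frac (ord t ∸ 1) 2)
      ≡⟨ ℚP.*-assoc (frac n e) _ _ ⟨
    frac n e ℚ.* frac e (ord t) ℚ.* frac (ord t ∸ 1) 2
      ≡⟨ ≡.cong (ℚ._* frac (ord t ∸ 1) 2) (Fractions.frac-cancel n e (ord t) 1≤e (proj₁ (orders t))) ⟩
    angle (ord t)
      ∎
    where
    q : ℕ → ℚ
    q m = frac e m ℚ.* frac (m ∸ 1) 2

  direct-coefficient : ∀ t → direct t ≡ angle (ord t)
  direct-coefficient t = GroupAlgebra.coefficient ord e angle t 1≤e (proj₁ (orders t)) (ord∣e t)

corollary2p1 : {c ℓ : Level} (K : CommutativeRing c ℓ) → IsField K → CharZero K →
    (n : ℕ) (G : FinGroup n) (e : ℕ) → IsExponent G e →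
    (ord : Fin n → ℕ) → (∀ s → IsOrder G s (ord s)) →
    (ζ : CommutativeRing.Carrier K) → IsPrimitiveRoot K e ζ →
    IsStickelberger K G e ζ ord (regChar K G e ζ)
    (frac n e · sumDiv e (λ m → (frac e m Data.Rational.* frac (m ∸ 1) 2) · elemsOfOrder ord m))
    × (∀ t → (frac n e · sumDiv e (λ m → (frac e m Data.Rational.* frac (m ∸ 1) 2) · elemsOfOrder ord m)) t
    ≡ sumDiv e (λ m → (frac n m Data.Rational.* frac (m ∸ 1) 2) · elemsOfOrder ord m) t)
corollary2p1 K fld cz n G e exponent ord orders ζ prim = stickelberger , coefficients-agree
  where
  open StatementCoefficients G e exponent ord orders
  open RegularPairing K fld cz G e exponent ζ prim using (regular-pairing)

  coefficients-agree : ∀ t → scaled t ≡ direct t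
  coefficients-agree t = ≡.trans (scaled-coefficient t) (≡.sym (direct-coefficient t))

  stickelberger : IsStickelberger K G e ζ ord (regChar K G e ζ) scaled
  stickelberger s q = mk⇔ (λ p → ≡.trans (to p) (≡.sym (scaled-coefficient s)))
                          (λ q≡θs → from (≡.trans q≡θs (scaled-coefficient s)))
    where open Equivalence (regular-pairing s (ord s) (orders s) q)
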